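{- Let $G=(V,E)$ be a $(D,c)$-uniform graph on $n$ vertices with $\delta$-mixing time $T(n)$, where $\delta:=(1/(2cn))^2$. Consider a random walk $(v_0,v_1,\dots,v_t)$ on $G$ starting from an arbitrary vertex, and let $i,j$ satisfy $j\ge i+T(n)$. Let $\mathcal E$ be any event that depends only on the first $i$ vertices visited by the walk. Then for every $u,v\in V$, $$\big|\Pr[v_i=u\mid v_j=v,\mathcal E]-\Pr[v_i=u\mid\mathcal E]\big|\le\frac{2}{3cn}.$$
   Context: $G$ is $(D,c)$-uniform ($c\ge1$) if every vertex degree lies between $D$ and $cD$. A random walk is the simple random walk: each step moves to a uniformly random neighbor of the current vertex. Let $\mu$ be the stationary distribution of the walk and $\mu^\tau_x$ the distribution of the endpoint of a random walk of length $\tau$ started at $x$. The $\delta$-mixing time is the smallest integer $t$ such that $\max_{w\in V}|\mu^\tau_x(w)-\mu(w)|\le\delta$ for all $\tau\ge t$ and all $x\in V$. -}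

module Defs where

open import Data.Nat as ℕ using (ℕ; zero; suc)
open import Data.Fin as Fin using (Fin)
open import Data.Bool using (Bool; true; false; if_then_else_)
open import Data.List as List using (List; []; _∷_; allFin; concatMap; foldr)
open import Data.Vec as Vec using (Vec; []; _∷_)
open import Data.Rational using (ℚ; 0ℚ; 1ℚ; _+_; _-_; _*_; _÷_; ∣_∣; _≤_; _<_; ≢-nonZero)
open import Data.Rational.Properties using (_≟_)
open import Relation.Nullary using (yes; no)
open import Relation.Nullary.Decidable using (⌊_⌋)
open import Relation.Binary.PropositionalEquality using (_≡_)
open import Data.Nat.ListAction using () renaming (sum to sumℕ)

ℕtoℚ : ℕ → ℚ
ℕtoℚ zero    = 0ℚ
ℕtoℚ (suc k) = 1ℚ + ℕtoℚ k

-- Division that returns 0 when the denominator is 0 (only used where it is nonzero)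
_/'_ : ℚ → ℚ → ℚ
p /' q with q ≟ 0ℚ
... | yes _  = 0ℚ
... | no q≢0 = _÷_ p q {{≢-nonZero q≢0}}

sumℚ : List ℚ → ℚ
sumℚ = foldr _+_ 0ℚ

record Graph (n : ℕ) : Set where
  field
    adj    : Fin n → Fin n → Bool
    symm   : ∀ a b → adj a b ≡ adj b a
    irrefl : ∀ a → adj a a ≡ false

module _ {n : ℕ} (G : Graph n) where
  open Graph G

  degree : Fin n → ℕ
  degree a = sumℕ (List.map (λ b → if adj a b then 1 else 0) (allFin n))

  IsUniform : ℚ → ℚ → Set
  IsUniform D c = ∀ v → (D ≤ ℕtoℚ (degree v)) Data.Product.× (ℕtoℚ (degree v) ≤ c * D)
    where import Data.Product

  step : Fin n → Fin n → ℚ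
  step a b = if adj a b then 1ℚ /' ℕtoℚ (degree a) else 0ℚ

  stepsFrom : ∀ {m} → Fin n → Vec (Fin n) m → ℚ
  stepsFrom a []      = 1ℚ
  stepsFrom a (b ∷ r) = step a b * stepsFrom b r

  pathProb : ∀ {m} → Fin n → Vec (Fin n) (suc m) → ℚ
  pathProb x (v ∷ r) = (if ⌊ v Fin.≟ x ⌋ then 1ℚ else 0ℚ) * stepsFrom v r

  allVecs : ∀ m → List (Vec (Fin n) m)
  allVecs zero    = [] ∷ []
  allVecs (suc m) = concatMap (λ v → List.map (_∷ v) (allFin n)) (allVecs m)

  Pr : (x : Fin n) (m : ℕ) → (Vec (Fin n) (suc m) → Bool) → ℚ
  Pr x m P = sumℚ (List.map (λ w → if P w then pathProb x w else 0ℚ) (allVecs (suc m)))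

  CondPr : (x : Fin n) (m : ℕ) → (A B : Vec (Fin n) (suc m) → Bool) → ℚ
  CondPr x m A B = Pr x m (λ w → A w Data.Bool.∧ B w) /' Pr x m B
    where import Data.Bool

  μτ : ℕ → Fin n → Fin n → ℚ
  μτ τ x w = Pr x τ (λ p → ⌊ Vec.last p Fin.≟ w ⌋)

  μ : Fin n → ℚ
  μ w = ℕtoℚ (degree w) /' ℕtoℚ (sumℕ (List.map degree (allFin n)))

  CloseAt : ℚ → ℕ → Set
  CloseAt δ τ = ∀ x w → ∣ μτ τ x w - μ w ∣ ≤ δ

  IsMixingTime : ℚ → ℕ → Set
  IsMixingTime δ T =
    (∀ τ → T ℕ.≤ τ → CloseAt δ τ) Data.Product.×
    (∀ t → t ℕ.< T → Data.Product.∃ λ τ → (t ℕ.≤ τ) Data.Product.× (CloseAt δ τ → Data.Empty.⊥))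
    where import Data.Product; import Data.Empty

-- Write U, V for the events v_i = u and v_j = v, and k = j − i ≥ T. By the Markov property at
-- time i, Pr[U ∧ V ∧ E] = μ^k_u(v) · Pr[U ∧ E], while Pr[V ∧ E] is the average of μ^k_a(v) over the
-- prefixes in E, weighted by their probabilities, so Pr[V ∧ E] / Pr[E] and μ^k_u(v) both lie in
-- [μ(v) − δ, μ(v) + δ]. Hence the two conditional probabilities differ by at most
-- Pr[U | E] · 2δ / (μ(v) − δ) ≤ 2δ / (μ(v) − δ), and μ(v) ≥ 1/(cn) on a (D,c)-uniform graph turns this
-- into 2/(3cn).
module Submission where

open import Defs
open import Data.Nat as ℕ using (ℕ; zero; suc; _+_)
open import Data.Fin as Fin using (Fin)
open import Data.Fin.Properties using (suc-injective; nonZeroIndex)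
open import Data.Bool using (Bool; true; false; _∧_; if_then_else_)
open import Data.Bool.Properties using (∧-assoc; ∧-comm; ∧-identityʳ)
open import Data.List as List using (List; []; _∷_; allFin; concatMap)
open import Data.List.Properties using (map-tabulate; length-tabulate)
open import Data.List.Membership.Propositional using (_∈_)
open import Data.List.Membership.Propositional.Properties using (∈-allFin)
open import Data.List.Relation.Unary.Any using (here; there)
open import Data.Vec as Vec using (Vec; []; _∷_; _++_)
open import Data.Rational as ℚ using (ℚ; 0ℚ; 1ℚ; ∣_∣; _≤_; _<_; _-_; _*_)
import Data.Rational.Properties as ℚ
open import Data.Rational.Solver using (module +-*-Solver)
open import Data.Nat.ListAction using () renaming (sum to sumℕ)
open import Data.Product using (_×_; _,_; proj₁; proj₂)
open import Data.Sum using (inj₁; inj₂)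
open import Function using (id; _∘_)
open import Relation.Nullary using (yes; no; contradiction)
open import Relation.Nullary.Decidable using (⌊_⌋)
open import Relation.Binary.PropositionalEquality

open +-*-Solver using (solve; _:+_; _:*_; _:-_; :-_; con; _:=_)

0<1 : 0ℚ < 1ℚ
0<1 = ℚ.positive⁻¹ 1ℚ

ℕtoℚ-+ : ∀ a b → ℕtoℚ (a + b) ≡ ℕtoℚ a ℚ.+ ℕtoℚ b
ℕtoℚ-+ zero    b = sym (ℚ.+-identityˡ _)
ℕtoℚ-+ (suc a) b = trans (cong (1ℚ ℚ.+_) (ℕtoℚ-+ a b)) (sym (ℚ.+-assoc 1ℚ (ℕtoℚ a) (ℕtoℚ b)))

ℕtoℚ-nonNeg : ∀ m → 0ℚ ≤ ℕtoℚ m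
ℕtoℚ-nonNeg zero    = ℚ.≤-refl
ℕtoℚ-nonNeg (suc m) = ℚ.+-mono-≤ (ℚ.<⇒≤ 0<1) (ℕtoℚ-nonNeg m)

ℕtoℚ-pos : ∀ {m} → 0 ℕ.< m → 0ℚ < ℕtoℚ m
ℕtoℚ-pos {suc m} _ = ℚ.+-mono-<-≤ 0<1 (ℕtoℚ-nonNeg m)

1≤ℕtoℚ : ∀ {m} → 0 ℕ.< m → 1ℚ ≤ ℕtoℚ m
1≤ℕtoℚ {suc m} _ = ℚ.+-monoʳ-≤ 1ℚ (ℕtoℚ-nonNeg m)

p≤q⇒0≤q-p : ∀ {p q} → p ≤ q → 0ℚ ≤ q - p
p≤q⇒0≤q-p {p} {q} p≤q = begin
  0ℚ     ≡⟨ ℚ.+-inverseʳ p ⟨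
  p - p  ≤⟨ ℚ.+-monoˡ-≤ (ℚ.- p) p≤q ⟩
  q - p  ∎
  where open ℚ.≤-Reasoning

0≤q-p⇒p≤q : ∀ {p q} → 0ℚ ≤ q - p → p ≤ q
0≤q-p⇒p≤q {p} {q} 0≤q-p = begin
  p              ≡⟨ ℚ.+-identityˡ p ⟨
  0ℚ ℚ.+ p       ≤⟨ ℚ.+-monoˡ-≤ p 0≤q-p ⟩
  (q - p) ℚ.+ p  ≡⟨ solve 2 (λ p q → (q :- p) :+ p := q) refl p q ⟩
  q              ∎
  where open ℚ.≤-Reasoning

≤-via-difference : ∀ {p q s} → q - p ≡ s → 0ℚ ≤ s → p ≤ q
≤-via-difference q-p≡s 0≤s = 0≤q-p⇒p≤q (subst (0ℚ ≤_) (sym q-p≡s) 0≤s)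

0≤p+q : ∀ {p q} → 0ℚ ≤ p → 0ℚ ≤ q → 0ℚ ≤ p ℚ.+ q
0≤p+q = ℚ.+-mono-≤

0≤p*q : ∀ {p q} → 0ℚ ≤ p → 0ℚ ≤ q → 0ℚ ≤ p * q
0≤p*q {p} {q} 0≤p 0≤q = ℚ.nonNegative⁻¹ (p * q)
  {{ℚ.nonNeg*nonNeg⇒nonNeg p {{ℚ.nonNegative 0≤p}} q {{ℚ.nonNegative 0≤q}}}}

0<p*q : ∀ {p q} → 0ℚ < p → 0ℚ < q → 0ℚ < p * q
0<p*q {p} {q} 0<p 0<q = ℚ.positive⁻¹ (p * q)
  {{ℚ.pos*pos⇒pos p {{ℚ.positive 0<p}} q {{ℚ.positive 0<q}}}}

*-monoʳ-≤ : ∀ {p q r} → 0ℚ ≤ r → p ≤ q → p * r ≤ q * r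
*-monoʳ-≤ {r = r} 0≤r = ℚ.*-monoʳ-≤-nonNeg r {{ℚ.nonNegative 0≤r}}

*-monoˡ-≤ : ∀ {p q r} → 0ℚ ≤ r → p ≤ q → r * p ≤ r * q
*-monoˡ-≤ {r = r} 0≤r = ℚ.*-monoˡ-≤-nonNeg r {{ℚ.nonNegative 0≤r}}

*-cancelʳ-≤ : ∀ {p q r} → 0ℚ < r → p * r ≤ q * r → p ≤ q
*-cancelʳ-≤ {r = r} 0<r = ℚ.*-cancelʳ-≤-pos r {{ℚ.positive 0<r}}

≤-via-scaled-difference : ∀ {p q r s} → 0ℚ < r → (q - p) * r ≡ s → 0ℚ ≤ s → p ≤ q
≤-via-scaled-difference {p} {q} {r} {s} 0<r [q-p]r≡s 0≤s = 0≤q-p⇒p≤q (*-cancelʳ-≤ 0<r (begin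
  0ℚ * r       ≡⟨ ℚ.*-zeroˡ r ⟩
  0ℚ           ≤⟨ 0≤s ⟩
  s            ≡⟨ [q-p]r≡s ⟨
  (q - p) * r  ∎))
  where open ℚ.≤-Reasoning

1≤p*q : ∀ {p q} → 1ℚ ≤ p → 1ℚ ≤ q → 1ℚ ≤ p * q
1≤p*q {p} {q} 1≤p 1≤q = begin
  1ℚ      ≤⟨ 1≤q ⟩
  q       ≡⟨ ℚ.*-identityˡ q ⟨
  1ℚ * q  ≤⟨ *-monoʳ-≤ (ℚ.≤-trans (ℚ.<⇒≤ 0<1) 1≤q) 1≤p ⟩
  p * q   ∎
  where open ℚ.≤-Reasoning

pos⇒≢0 : ∀ {q} → 0ℚ < q → q ≢ 0ℚ
pos⇒≢0 0<q = ≢-sym (ℚ.<⇒≢ 0<q)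

/'-*-cancel : ∀ p {q} → q ≢ 0ℚ → (p /' q) * q ≡ p
/'-*-cancel p {q} q≢0 with q ℚ.≟ 0ℚ
... | yes q≡0 = contradiction q≡0 q≢0
... | no  q≢0 = begin
  p * ℚ.1/ q * q    ≡⟨ ℚ.*-assoc p _ q ⟩
  p * (ℚ.1/ q * q)  ≡⟨ cong (p *_) (ℚ.*-inverseˡ q) ⟩
  p * 1ℚ            ≡⟨ ℚ.*-identityʳ p ⟩
  p                 ∎
  where
  open ≡-Reasoning
  instance _ = ℚ.≢-nonZero q≢0

/'-nonNeg : ∀ {p q} → 0ℚ ≤ p → 0ℚ < q → 0ℚ ≤ p /' q
/'-nonNeg {p} {q} 0≤p 0<q = *-cancelʳ-≤ 0<q (begin
  0ℚ * q        ≡⟨ ℚ.*-zeroˡ q ⟩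
  0ℚ            ≤⟨ 0≤p ⟩
  p             ≡⟨ /'-*-cancel p (pos⇒≢0 0<q) ⟨
  (p /' q) * q  ∎)
  where open ℚ.≤-Reasoning

p≤∣p∣ : ∀ p → p ≤ ∣ p ∣
p≤∣p∣ p with ℚ.≤-total 0ℚ p
... | inj₁ 0≤p = ℚ.≤-reflexive (sym (ℚ.0≤p⇒∣p∣≡p 0≤p))
... | inj₂ p≤0 = ℚ.≤-trans p≤0 (ℚ.0≤∣p∣ p)

-p≤∣p∣ : ∀ p → ℚ.- p ≤ ∣ p ∣
-p≤∣p∣ p = subst (ℚ.- p ≤_) (ℚ.∣-p∣≡∣p∣ p) (p≤∣p∣ (ℚ.- p))

∣p∣≤q : ∀ {p q} → p ≤ q → ℚ.- p ≤ q → ∣ p ∣ ≤ q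
∣p∣≤q {p} p≤q -p≤q with ℚ.∣p∣≡p∨∣p∣≡-p p
... | inj₁ ∣p∣≡p  = subst (_≤ _) (sym ∣p∣≡p) p≤q
... | inj₂ ∣p∣≡-p = subst (_≤ _) (sym ∣p∣≡-p) -p≤q

infix 4 _∈[_,_]

_∈[_,_] : ℚ → ℚ → ℚ → Set
x ∈[ lo , hi ] = lo ≤ x × x ≤ hi

∣p-q∣≤r⇒∈ : ∀ {p q r} → ∣ p - q ∣ ≤ r → p ∈[ q - r , q ℚ.+ r ]
∣p-q∣≤r⇒∈ {p} {q} {r} ∣p-q∣≤r =
  ≤-via-difference (solve 3 (λ p q r → p :- (q :- r) := r :- (:- (p :- q))) refl p q r)
    (p≤q⇒0≤q-p (ℚ.≤-trans (-p≤∣p∣ (p - q)) ∣p-q∣≤r)) ,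
  ≤-via-difference (solve 3 (λ p q r → (q :+ r) :- p := r :- (p :- q)) refl p q r)
    (p≤q⇒0≤q-p (ℚ.≤-trans (p≤∣p∣ (p - q)) ∣p-q∣≤r))

∣-∣≤width : ∀ {x y lo hi} → x ∈[ lo , hi ] → y ∈[ lo , hi ] → ∣ x - y ∣ ≤ hi - lo
∣-∣≤width {x} {y} {lo} {hi} (lo≤x , x≤hi) (lo≤y , y≤hi) = ∣p∣≤q
  (≤-via-difference
    (solve 4 (λ x y lo hi → (hi :- lo) :- (x :- y) := (hi :- x) :+ (y :- lo)) refl x y lo hi)
    (0≤p+q (p≤q⇒0≤q-p x≤hi) (p≤q⇒0≤q-p lo≤y)))
  (≤-via-difference
    (solve 4 (λ x y lo hi → (hi :- lo) :- (:- (x :- y)) := (hi :- y) :+ (x :- lo)) refl x y lo hi)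
    (0≤p+q (p≤q⇒0≤q-p y≤hi) (p≤q⇒0≤q-p lo≤x)))

*-∈ : ∀ {x lo hi r} → 0ℚ ≤ r → x ∈[ lo , hi ] → x * r ∈[ lo * r , hi * r ]
*-∈ 0≤r (lo≤x , x≤hi) = *-monoʳ-≤ 0≤r lo≤x , *-monoʳ-≤ 0≤r x≤hi

∑ : ∀ {A : Set} → List A → (A → ℚ) → ℚ
∑ xs f = sumℚ (List.map f xs)

syntax ∑ xs (λ x → e) = ∑[ x ∈ xs ] e

∑-++ : ∀ {A : Set} (xs ys : List A) f → ∑ (xs List.++ ys) f ≡ ∑ xs f ℚ.+ ∑ ys f
∑-++ []       ys f = sym (ℚ.+-identityˡ _)
∑-++ (x ∷ xs) ys f = trans (cong (f x ℚ.+_) (∑-++ xs ys f)) (sym (ℚ.+-assoc (f x) _ _))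

module _ {A : Set} where

  ∑-cong : ∀ {f g : A → ℚ} (xs : List A) → (∀ x → f x ≡ g x) → ∑ xs f ≡ ∑ xs g
  ∑-cong []       f≗g = refl
  ∑-cong (x ∷ xs) f≗g = cong₂ ℚ._+_ (f≗g x) (∑-cong xs f≗g)

  ∑-map : ∀ {B : Set} (g : A → B) xs (f : B → ℚ) → ∑ (List.map g xs) f ≡ ∑ xs (f ∘ g)
  ∑-map g []       f = refl
  ∑-map g (x ∷ xs) f = cong (f (g x) ℚ.+_) (∑-map g xs f)

  ∑-concatMap : ∀ {B : Set} (g : A → List B) xs (f : B → ℚ) →
    ∑ (concatMap g xs) f ≡ ∑[ x ∈ xs ] ∑ (g x) f
  ∑-concatMap g []       f = refl
  ∑-concatMap g (x ∷ xs) f =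
    trans (∑-++ (g x) (concatMap g xs) f) (cong (∑ (g x) f ℚ.+_) (∑-concatMap g xs f))

  ∑-zero : ∀ (xs : List A) → ∑[ x ∈ xs ] 0ℚ ≡ 0ℚ
  ∑-zero []       = refl
  ∑-zero (x ∷ xs) = cong (0ℚ ℚ.+_) (∑-zero xs)

  ∑-distrib-+ : ∀ xs (f g : A → ℚ) → ∑[ x ∈ xs ] (f x ℚ.+ g x) ≡ ∑ xs f ℚ.+ ∑ xs g
  ∑-distrib-+ []       f g = refl
  ∑-distrib-+ (x ∷ xs) f g = trans (cong (f x ℚ.+ g x ℚ.+_) (∑-distrib-+ xs f g))
    (solve 4 (λ a b c d → (a :+ b) :+ (c :+ d) := (a :+ c) :+ (b :+ d)) refl (f x) (g x) (∑ xs f) (∑ xs g))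

  *-distribˡ-∑ : ∀ c xs (f : A → ℚ) → ∑[ x ∈ xs ] (c * f x) ≡ c * ∑ xs f
  *-distribˡ-∑ c []       f = sym (ℚ.*-zeroʳ c)
  *-distribˡ-∑ c (x ∷ xs) f =
    trans (cong (c * f x ℚ.+_) (*-distribˡ-∑ c xs f)) (sym (ℚ.*-distribˡ-+ c (f x) (∑ xs f)))

  ∑-mono-≤ : ∀ {f g : A → ℚ} xs → (∀ x → f x ≤ g x) → ∑ xs f ≤ ∑ xs g
  ∑-mono-≤ []       f≤g = ℚ.≤-refl
  ∑-mono-≤ (x ∷ xs) f≤g = ℚ.+-mono-≤ (f≤g x) (∑-mono-≤ xs f≤g)

  ∑-nonNeg : ∀ {f : A → ℚ} xs → (∀ x → 0ℚ ≤ f x) → 0ℚ ≤ ∑ xs f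
  ∑-nonNeg {f} xs 0≤f = subst (_≤ ∑ xs f) (∑-zero xs) (∑-mono-≤ xs 0≤f)

  ∑-≥-member : ∀ {f : A → ℚ} {x xs} → (∀ y → 0ℚ ≤ f y) → x ∈ xs → f x ≤ ∑ xs f
  ∑-≥-member {f} {xs = y ∷ ys} 0≤f (here refl) =
    subst (_≤ ∑ (y ∷ ys) f) (ℚ.+-identityʳ (f y)) (ℚ.+-monoʳ-≤ (f y) (∑-nonNeg ys 0≤f))
  ∑-≥-member {f} {xs = y ∷ ys} 0≤f (there x∈ys) =
    subst (_≤ ∑ (y ∷ ys) f) (ℚ.+-identityˡ _) (ℚ.+-mono-≤ (0≤f y) (∑-≥-member 0≤f x∈ys))

  ∑-const : ∀ (xs : List A) c → ∑[ x ∈ xs ] c ≡ ℕtoℚ (List.length xs) * c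
  ∑-const []       c = sym (ℚ.*-zeroˡ c)
  ∑-const (x ∷ xs) c = trans (cong (c ℚ.+_) (∑-const xs c))
    (solve 2 (λ c l → c :+ l :* c := (con 1ℚ :+ l) :* c) refl c (ℕtoℚ (List.length xs)))

  ∑-weighted-∈ : ∀ (xs : List A) {w f : A → ℚ} {lo hi} →
    (∀ x → 0ℚ ≤ w x) → (∀ x → f x ∈[ lo , hi ]) →
    ∑[ x ∈ xs ] (w x * f x) ∈[ lo * ∑ xs w , hi * ∑ xs w ]
  ∑-weighted-∈ xs {w} {f} {lo} {hi} 0≤w f∈ =
    subst (_≤ ∑[ x ∈ xs ] (w x * f x)) (*-distribˡ-∑ lo xs w) (∑-mono-≤ xs λ x →
      subst (_≤ w x * f x) (ℚ.*-comm (w x) lo) (*-monoˡ-≤ (0≤w x) (proj₁ (f∈ x)))) ,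
    subst (∑[ x ∈ xs ] (w x * f x) ≤_) (*-distribˡ-∑ hi xs w) (∑-mono-≤ xs λ x →
      subst (w x * f x ≤_) (ℚ.*-comm (w x) hi) (*-monoˡ-≤ (0≤w x) (proj₂ (f∈ x))))

∑-comm : ∀ {A B : Set} xs ys (f : A → B → ℚ) →
  ∑[ x ∈ xs ] ∑[ y ∈ ys ] f x y ≡ ∑[ y ∈ ys ] ∑[ x ∈ xs ] f x y
∑-comm []       ys f = sym (∑-zero ys)
∑-comm (x ∷ xs) ys f = trans (cong (∑ ys (f x) ℚ.+_) (∑-comm xs ys f))
  (sym (∑-distrib-+ ys (f x) (λ y → ∑[ x ∈ xs ] f x y)))

ℕtoℚ-sum : ∀ {A : Set} (xs : List A) (f : A → ℕ) → ℕtoℚ (sumℕ (List.map f xs)) ≡ ∑ xs (ℕtoℚ ∘ f)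
ℕtoℚ-sum []       f = refl
ℕtoℚ-sum (x ∷ xs) f = trans (ℕtoℚ-+ (f x) _) (cong (ℕtoℚ (f x) ℚ.+_) (ℕtoℚ-sum xs f))

∑-allFin-suc : ∀ {n} (f : Fin (suc n) → ℚ) →
  ∑ (allFin (suc n)) f ≡ f Fin.zero ℚ.+ ∑ (allFin n) (f ∘ Fin.suc)
∑-allFin-suc {n} f = cong (λ xs → f Fin.zero ℚ.+ sumℚ xs)
  (trans (map-tabulate Fin.suc f) (sym (map-tabulate id (f ∘ Fin.suc))))

∑-allFin-single : ∀ {n} (f : Fin n → ℚ) a → (∀ b → b ≢ a → f b ≡ 0ℚ) → ∑ (allFin n) f ≡ f a
∑-allFin-single {suc n} f Fin.zero off = begin
  ∑ (allFin (suc n)) f                       ≡⟨ ∑-allFin-suc f ⟩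
  f Fin.zero ℚ.+ ∑ (allFin n) (f ∘ Fin.suc)  ≡⟨ cong (f Fin.zero ℚ.+_) (∑-cong (allFin n) λ b → off (Fin.suc b) λ ()) ⟩
  f Fin.zero ℚ.+ ∑[ b ∈ allFin n ] 0ℚ        ≡⟨ cong (f Fin.zero ℚ.+_) (∑-zero (allFin n)) ⟩
  f Fin.zero ℚ.+ 0ℚ                          ≡⟨ ℚ.+-identityʳ (f Fin.zero) ⟩
  f Fin.zero                                 ∎
  where open ≡-Reasoning
∑-allFin-single {suc n} f (Fin.suc a) off = begin
  ∑ (allFin (suc n)) f                       ≡⟨ ∑-allFin-suc f ⟩
  f Fin.zero ℚ.+ ∑ (allFin n) (f ∘ Fin.suc)  ≡⟨ cong (ℚ._+ ∑ (allFin n) (f ∘ Fin.suc)) (off Fin.zero λ ()) ⟩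
  0ℚ ℚ.+ ∑ (allFin n) (f ∘ Fin.suc)          ≡⟨ ℚ.+-identityˡ _ ⟩
  ∑ (allFin n) (f ∘ Fin.suc)                 ≡⟨ ∑-allFin-single (f ∘ Fin.suc) a off-suc ⟩
  f (Fin.suc a)                              ∎
  where
  open ≡-Reasoning
  off-suc : ∀ b → b ≢ a → f (Fin.suc b) ≡ 0ℚ
  off-suc b b≢a = off (Fin.suc b) (b≢a ∘ suc-injective)

ratio-perturbation : ∀ {p₁ p₂ p₃ p₄ m lo hi β} →
  p₁ ≡ m * p₃ → 0ℚ ≤ p₃ → p₃ ≤ p₄ → 0ℚ < p₂ → 0ℚ < p₄ →
  m ∈[ lo , hi ] → p₂ ∈[ lo * p₄ , hi * p₄ ] →
  0ℚ ≤ β → hi - lo ≤ β * lo →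
  ∣ p₁ /' p₂ - p₃ /' p₄ ∣ ≤ β
ratio-perturbation {p₁} {p₂} {p₃} {p₄} {m} {lo} {hi} {β}
                   p₁≡mp₃ 0≤p₃ p₃≤p₄ 0<p₂ 0<p₄ m∈ p₂∈ 0≤β hi-lo≤βlo =
  *-cancelʳ-≤ (0<p*q 0<p₂ 0<p₄) (begin
    ∣ X ∣ * (p₂ * p₄)         ≡⟨ ∣X∣-scaled ⟩
    p₃ * ∣ m * p₄ - p₂ ∣      ≤⟨ *-monoʳ-≤ (ℚ.0≤∣p∣ _) p₃≤p₄ ⟩
    p₄ * ∣ m * p₄ - p₂ ∣      ≤⟨ *-monoˡ-≤ 0≤p₄ (∣-∣≤width (*-∈ 0≤p₄ m∈) p₂∈) ⟩
    p₄ * (hi * p₄ - lo * p₄)  ≡⟨ solve 3 (λ p₄ hi lo → p₄ :* (hi :* p₄ :- lo :* p₄) := p₄ :* ((hi :- lo) :* p₄))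
                                   refl p₄ hi lo ⟩
    p₄ * ((hi - lo) * p₄)     ≤⟨ *-monoˡ-≤ 0≤p₄ (*-monoʳ-≤ 0≤p₄ hi-lo≤βlo) ⟩
    p₄ * (β * lo * p₄)        ≡⟨ cong (p₄ *_) (ℚ.*-assoc β lo p₄) ⟩
    p₄ * (β * (lo * p₄))      ≤⟨ *-monoˡ-≤ 0≤p₄ (*-monoˡ-≤ 0≤β (proj₁ p₂∈)) ⟩
    p₄ * (β * p₂)             ≡⟨ solve 3 (λ p₂ p₄ β → p₄ :* (β :* p₂) := β :* (p₂ :* p₄)) refl p₂ p₄ β ⟩
    β * (p₂ * p₄)             ∎)
  where
  open ℚ.≤-Reasoning
  X = p₁ /' p₂ - p₃ /' p₄
  0≤p₄ = ℚ.<⇒≤ 0<p₄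

  cross-multiplied : X * (p₂ * p₄) ≡ p₃ * (m * p₄ - p₂)
  cross-multiplied = begin-equality
    X * (p₂ * p₄)
      ≡⟨ solve 4 (λ a b p₂ p₄ → (a :- b) :* (p₂ :* p₄) := (a :* p₂) :* p₄ :- (b :* p₄) :* p₂)
           refl (p₁ /' p₂) (p₃ /' p₄) p₂ p₄ ⟩
    (p₁ /' p₂ * p₂) * p₄ - (p₃ /' p₄ * p₄) * p₂
      ≡⟨ cong₂ (λ a b → a * p₄ - b * p₂)
           (trans (/'-*-cancel p₁ (pos⇒≢0 0<p₂)) p₁≡mp₃) (/'-*-cancel p₃ (pos⇒≢0 0<p₄)) ⟩
    (m * p₃) * p₄ - p₃ * p₂
      ≡⟨ solve 4 (λ m p₂ p₃ p₄ → (m :* p₃) :* p₄ :- p₃ :* p₂ := p₃ :* (m :* p₄ :- p₂)) refl m p₂ p₃ p₄ ⟩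
    p₃ * (m * p₄ - p₂) ∎

  ∣X∣-scaled : ∣ X ∣ * (p₂ * p₄) ≡ p₃ * ∣ m * p₄ - p₂ ∣
  ∣X∣-scaled = begin-equality
    ∣ X ∣ * (p₂ * p₄)         ≡⟨ cong (∣ X ∣ *_) (ℚ.0≤p⇒∣p∣≡p (ℚ.<⇒≤ (0<p*q 0<p₂ 0<p₄))) ⟨
    ∣ X ∣ * ∣ p₂ * p₄ ∣       ≡⟨ ℚ.∣p*q∣≡∣p∣*∣q∣ X (p₂ * p₄) ⟨
    ∣ X * (p₂ * p₄) ∣         ≡⟨ cong ∣_∣ cross-multiplied ⟩
    ∣ p₃ * (m * p₄ - p₂) ∣    ≡⟨ ℚ.∣p*q∣≡∣p∣*∣q∣ p₃ _ ⟩
    ∣ p₃ ∣ * ∣ m * p₄ - p₂ ∣  ≡⟨ cong (_* ∣ m * p₄ - p₂ ∣) (ℚ.0≤p⇒∣p∣≡p 0≤p₃) ⟩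
    p₃ * ∣ m * p₄ - p₂ ∣      ∎

-- With K = cN, h = 1/(2K) and β = 2/(3K), the margin β(μ − h²) − 2h² scaled by 12K³ is
-- 8K(μK − 1) + 2(K − 1).
mixing-margin : ∀ {μ h β c N} → 1ℚ ≤ c * N → 1ℚ ≤ μ * (c * N) →
  h * (ℕtoℚ 2 * c * N) ≡ 1ℚ → β * (ℕtoℚ 3 * c * N) ≡ ℕtoℚ 2 →
  (μ ℚ.+ h * h) - (μ - h * h) ≤ β * (μ - h * h)
mixing-margin {μ} {h} {β} {c} {N} 1≤K 1≤μK 2hK≡1 3βK≡2 =
  ≤-via-scaled-difference (0<p*q (0<p*q (0<p*q (ℕtoℚ-pos {12} ℕ.z<s) 0<K) 0<K) 0<K) scaled
    (0≤p+q (0≤p*q (0≤p*q (ℕtoℚ-nonNeg 8) (ℚ.<⇒≤ 0<K)) (p≤q⇒0≤q-p 1≤μK))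
           (0≤p*q (ℕtoℚ-nonNeg 2) (p≤q⇒0≤q-p 1≤K)))
  where
  open ≡-Reasoning
  K = c * N
  0<K = ℚ.<-≤-trans 0<1 1≤K
  2hK = h * (ℕtoℚ 2 * c * N)
  3βK = β * (ℕtoℚ 3 * c * N)
  scaled : (β * (μ - h * h) - ((μ ℚ.+ h * h) - (μ - h * h))) * (ℕtoℚ 12 * K * K * K)
         ≡ ℕtoℚ 8 * K * (μ * K - 1ℚ) ℚ.+ ℕtoℚ 2 * (K - 1ℚ)
  scaled = begin
    (β * (μ - h * h) - ((μ ℚ.+ h * h) - (μ - h * h))) * (ℕtoℚ 12 * K * K * K)
      ≡⟨ solve 5 (λ μ h β c N →
           let K = c :* N; 2hK = h :* (con (ℕtoℚ 2) :* c :* N); 3βK = β :* (con (ℕtoℚ 3) :* c :* N) in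
           (β :* (μ :- h :* h) :- ((μ :+ h :* h) :- (μ :- h :* h))) :* (con (ℕtoℚ 12) :* K :* K :* K)
           := con (ℕtoℚ 4) :* K :* K :* μ :* 3βK :- 3βK :* 2hK :* 2hK :- con (ℕtoℚ 6) :* K :* 2hK :* 2hK)
           refl μ h β c N ⟩
    ℕtoℚ 4 * K * K * μ * 3βK - 3βK * 2hK * 2hK - ℕtoℚ 6 * K * 2hK * 2hK
      ≡⟨ cong₂ (λ b t → ℕtoℚ 4 * K * K * μ * b - b * t * t - ℕtoℚ 6 * K * t * t) 3βK≡2 2hK≡1 ⟩
    ℕtoℚ 4 * K * K * μ * ℕtoℚ 2 - ℕtoℚ 2 * 1ℚ * 1ℚ - ℕtoℚ 6 * K * 1ℚ * 1ℚ
      ≡⟨ solve 2 (λ μ K →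
           con (ℕtoℚ 4) :* K :* K :* μ :* con (ℕtoℚ 2) :- con (ℕtoℚ 2) :* con 1ℚ :* con 1ℚ
             :- con (ℕtoℚ 6) :* K :* con 1ℚ :* con 1ℚ
           := con (ℕtoℚ 8) :* K :* (μ :* K :- con 1ℚ) :+ con (ℕtoℚ 2) :* (K :- con 1ℚ))
           refl μ K ⟩
    ℕtoℚ 8 * K * (μ * K - 1ℚ) ℚ.+ ℕtoℚ 2 * (K - 1ℚ) ∎

take-++ : ∀ {A : Set} {m k} (p : Vec A m) (q : Vec A k) → Vec.take m (p ++ q) ≡ p
take-++ []      q = refl
take-++ (a ∷ p) q = cong (a ∷_) (take-++ p q)

last-++ : ∀ {A : Set} {m k} (p : Vec A (suc m)) (q : Vec A k) →
  Vec.last (p ++ q) ≡ Vec.last (Vec.last p ∷ q)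
last-++ (a ∷ [])    q = refl
last-++ (a ∷ b ∷ p) q = last-++ (b ∷ p) q

if-∧-* : ∀ a b (X Y : ℚ) →
  (if a ∧ b then X * Y else 0ℚ) ≡ (if a then X else 0ℚ) * (if b then Y else 0ℚ)
if-∧-* true  true  X Y = refl
if-∧-* true  false X Y = sym (ℚ.*-zeroʳ X)
if-∧-* false b     X Y = sym (ℚ.*-zeroˡ (if b then Y else 0ℚ))

if-nonNeg : ∀ b {X} → 0ℚ ≤ X → 0ℚ ≤ (if b then X else 0ℚ)
if-nonNeg true  0≤X = 0≤X
if-nonNeg false 0≤X = ℚ.≤-refl

if-∧-≤ : ∀ a b {X} → 0ℚ ≤ X → (if a ∧ b then X else 0ℚ) ≤ (if b then X else 0ℚ)
if-∧-≤ true  b     0≤X = ℚ.≤-refl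
if-∧-≤ false true  0≤X = 0≤X
if-∧-≤ false false 0≤X = ℚ.≤-refl

module _ {n : ℕ} (G : Graph n) where
  open Graph G

  ∑-allVecs-suc : ∀ m (f : Vec (Fin n) (suc m) → ℚ) →
    ∑ (allVecs G (suc m)) f ≡ ∑[ a ∈ allFin n ] ∑[ r ∈ allVecs G m ] f (a ∷ r)
  ∑-allVecs-suc m f = begin
    ∑ (allVecs G (suc m)) f
      ≡⟨ ∑-concatMap (λ r → List.map (_∷ r) (allFin n)) (allVecs G m) f ⟩
    ∑[ r ∈ allVecs G m ] ∑ (List.map (_∷ r) (allFin n)) f
      ≡⟨ ∑-cong (allVecs G m) (λ r → ∑-map (_∷ r) (allFin n) f) ⟩
    ∑[ r ∈ allVecs G m ] ∑[ a ∈ allFin n ] f (a ∷ r)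
      ≡⟨ ∑-comm (allVecs G m) (allFin n) (λ r a → f (a ∷ r)) ⟩
    ∑[ a ∈ allFin n ] ∑[ r ∈ allVecs G m ] f (a ∷ r) ∎
    where open ≡-Reasoning

  ∑-allVecs-++ : ∀ m k (f : Vec (Fin n) (m + k) → ℚ) →
    ∑ (allVecs G (m + k)) f ≡ ∑[ p ∈ allVecs G m ] ∑[ q ∈ allVecs G k ] f (p ++ q)
  ∑-allVecs-++ zero    k f = sym (ℚ.+-identityʳ _)
  ∑-allVecs-++ (suc m) k f = begin
    ∑ (allVecs G (suc m + k)) f
      ≡⟨ ∑-allVecs-suc (m + k) f ⟩
    ∑[ a ∈ allFin n ] ∑[ r ∈ allVecs G (m + k) ] f (a ∷ r)
      ≡⟨ ∑-cong (allFin n) (λ a → ∑-allVecs-++ m k (f ∘ (a ∷_))) ⟩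
    ∑[ a ∈ allFin n ] ∑[ p ∈ allVecs G m ] ∑[ q ∈ allVecs G k ] f (a ∷ p ++ q)
      ≡⟨ ∑-allVecs-suc m (λ p → ∑[ q ∈ allVecs G k ] f (p ++ q)) ⟨
    ∑[ p ∈ allVecs G (suc m) ] ∑[ q ∈ allVecs G k ] f (p ++ q) ∎
    where open ≡-Reasoning

  stepsFrom-++ : ∀ {m k} a (r : Vec (Fin n) m) (q : Vec (Fin n) k) →
    stepsFrom G a (r ++ q) ≡ stepsFrom G a r * stepsFrom G (Vec.last (a ∷ r)) q
  stepsFrom-++ a []      q = sym (ℚ.*-identityˡ _)
  stepsFrom-++ a (b ∷ r) q =
    trans (cong (step G a b *_) (stepsFrom-++ b r q)) (sym (ℚ.*-assoc (step G a b) _ _))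

  pathProb-++ : ∀ {m k} x (p : Vec (Fin n) (suc m)) (q : Vec (Fin n) k) →
    pathProb G x (p ++ q) ≡ pathProb G x p * stepsFrom G (Vec.last p) q
  pathProb-++ x (a ∷ r) q =
    trans (cong (starts-at-x *_) (stepsFrom-++ a r q)) (sym (ℚ.*-assoc starts-at-x _ _))
    where starts-at-x = if ⌊ a Fin.≟ x ⌋ then 1ℚ else 0ℚ

  pathProbIf : ∀ {m} → (Vec (Fin n) (suc m) → Bool) → Fin n → Vec (Fin n) (suc m) → ℚ
  pathProbIf A x p = if A p then pathProb G x p else 0ℚ

  Pr-cong : ∀ x m {P Q : Vec (Fin n) (suc m) → Bool} → (∀ w → P w ≡ Q w) → Pr G x m P ≡ Pr G x m Q
  Pr-cong x m P≗Q = ∑-cong (allVecs G (suc m)) λ w → cong (λ b → if b then pathProb G x w else 0ℚ) (P≗Q w)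

  Pr-start : ∀ a m (P : Vec (Fin n) (suc m) → Bool) →
    Pr G a m P ≡ ∑[ q ∈ allVecs G m ] (if P (a ∷ q) then stepsFrom G a q else 0ℚ)
  Pr-start a m P = begin
    Pr G a m P
      ≡⟨ ∑-allVecs-suc m (pathProbIf P a) ⟩
    ∑[ b ∈ allFin n ] ∑[ q ∈ allVecs G m ] pathProbIf P a (b ∷ q)
      ≡⟨ ∑-allFin-single _ a (λ b b≢a → trans (∑-cong (allVecs G m) (off b≢a)) (∑-zero (allVecs G m))) ⟩
    ∑[ q ∈ allVecs G m ] pathProbIf P a (a ∷ q)
      ≡⟨ ∑-cong (allVecs G m) on ⟩
    ∑[ q ∈ allVecs G m ] (if P (a ∷ q) then stepsFrom G a q else 0ℚ) ∎
    where
    open ≡-Reasoning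
    off : ∀ {b} → b ≢ a → ∀ q → pathProbIf P a (b ∷ q) ≡ 0ℚ
    off {b} b≢a q with b Fin.≟ a | P (b ∷ q)
    ... | yes b≡a | _     = contradiction b≡a b≢a
    ... | no _    | true  = ℚ.*-zeroˡ (stepsFrom G b q)
    ... | no _    | false = refl
    on : ∀ q → pathProbIf P a (a ∷ q) ≡ (if P (a ∷ q) then stepsFrom G a q else 0ℚ)
    on q with a Fin.≟ a | P (a ∷ q)
    ... | no a≢a | _     = contradiction refl a≢a
    ... | yes _  | true  = ℚ.*-identityˡ _
    ... | yes _  | false = refl

  Pr-markov : ∀ x i k (A : Vec (Fin n) (suc i) → Bool) (B : Fin n → Bool) →
    Pr G x (i + k) (λ w → A (Vec.take (suc i) w) ∧ B (Vec.last w))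
      ≡ ∑[ p ∈ allVecs G (suc i) ] (pathProbIf A x p * Pr G (Vec.last p) k (B ∘ Vec.last))
  Pr-markov x i k A B = begin
    Pr G x (i + k) A∧B
      ≡⟨ ∑-allVecs-++ (suc i) k (pathProbIf A∧B x) ⟩
    ∑[ p ∈ allVecs G (suc i) ] ∑[ q ∈ allVecs G k ] pathProbIf A∧B x (p ++ q)
      ≡⟨ ∑-cong (allVecs G (suc i)) (λ p → ∑-cong (allVecs G k) (factor p)) ⟩
    ∑[ p ∈ allVecs G (suc i) ] ∑[ q ∈ allVecs G k ] (pathProbIf A x p * ends-in-B p q)
      ≡⟨ ∑-cong (allVecs G (suc i)) (λ p → *-distribˡ-∑ (pathProbIf A x p) (allVecs G k) (ends-in-B p)) ⟩
    ∑[ p ∈ allVecs G (suc i) ] (pathProbIf A x p * ∑ (allVecs G k) (ends-in-B p))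
      ≡⟨ ∑-cong (allVecs G (suc i)) (λ p → cong (pathProbIf A x p *_) (Pr-start (Vec.last p) k _)) ⟨
    ∑[ p ∈ allVecs G (suc i) ] (pathProbIf A x p * Pr G (Vec.last p) k (B ∘ Vec.last)) ∎
    where
    open ≡-Reasoning
    A∧B : Vec (Fin n) (suc (i + k)) → Bool
    A∧B w = A (Vec.take (suc i) w) ∧ B (Vec.last w)
    ends-in-B : Vec (Fin n) (suc i) → Vec (Fin n) k → ℚ
    ends-in-B p q = if B (Vec.last (Vec.last p ∷ q)) then stepsFrom G (Vec.last p) q else 0ℚ
    factor : ∀ p q → pathProbIf A∧B x (p ++ q) ≡ pathProbIf A x p * ends-in-B p q
    factor p q rewrite take-++ p q | last-++ p q | pathProb-++ x p q =
      if-∧-* (A p) (B (Vec.last (Vec.last p ∷ q))) _ _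

  module _ (deg>0 : ∀ v → 0 ℕ.< degree G v) where

    step-nonNeg : ∀ a b → 0ℚ ≤ step G a b
    step-nonNeg a b with adj a b
    ... | true  = /'-nonNeg (ℚ.<⇒≤ 0<1) (ℕtoℚ-pos (deg>0 a))
    ... | false = ℚ.≤-refl

    stepsFrom-nonNeg : ∀ {m} a (r : Vec (Fin n) m) → 0ℚ ≤ stepsFrom G a r
    stepsFrom-nonNeg a []      = ℚ.<⇒≤ 0<1
    stepsFrom-nonNeg a (b ∷ r) = 0≤p*q (step-nonNeg a b) (stepsFrom-nonNeg b r)

    pathProb-nonNeg : ∀ {m} x (p : Vec (Fin n) (suc m)) → 0ℚ ≤ pathProb G x p
    pathProb-nonNeg x (a ∷ r) = 0≤p*q (if-nonNeg ⌊ a Fin.≟ x ⌋ (ℚ.<⇒≤ 0<1)) (stepsFrom-nonNeg a r)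

    Pr-nonNeg : ∀ x m (P : Vec (Fin n) (suc m) → Bool) → 0ℚ ≤ Pr G x m P
    Pr-nonNeg x m P = ∑-nonNeg (allVecs G (suc m)) λ w → if-nonNeg (P w) (pathProb-nonNeg x w)

    Pr-∧-≤ : ∀ x m (P Q : Vec (Fin n) (suc m) → Bool) → Pr G x m (λ w → P w ∧ Q w) ≤ Pr G x m Q
    Pr-∧-≤ x m P Q = ∑-mono-≤ (allVecs G (suc m)) λ w → if-∧-≤ (P w) (Q w) (pathProb-nonNeg x w)

    step-row-sum : ∀ a → ∑ (allFin n) (step G a) ≡ 1ℚ
    step-row-sum a = begin
      ∑ (allFin n) (step G a)                    ≡⟨ ∑-cong (allFin n) step≡ ⟩
      ∑[ b ∈ allFin n ] (r * ℕtoℚ (adjacent b))  ≡⟨ *-distribˡ-∑ r (allFin n) (ℕtoℚ ∘ adjacent) ⟩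
      r * ∑ (allFin n) (ℕtoℚ ∘ adjacent)         ≡⟨ cong (r *_) (ℕtoℚ-sum (allFin n) adjacent) ⟨
      r * ℕtoℚ (degree G a)                      ≡⟨ /'-*-cancel 1ℚ (pos⇒≢0 (ℕtoℚ-pos (deg>0 a))) ⟩
      1ℚ                                         ∎
      where
      open ≡-Reasoning
      r = 1ℚ /' ℕtoℚ (degree G a)
      adjacent : Fin n → ℕ
      adjacent b = if adj a b then 1 else 0
      step≡ : ∀ b → step G a b ≡ r * ℕtoℚ (adjacent b)
      step≡ b with adj a b
      ... | true  = sym (ℚ.*-identityʳ r)
      ... | false = sym (ℚ.*-zeroʳ r)

    ∑-stepsFrom : ∀ k a → ∑ (allVecs G k) (stepsFrom G a) ≡ 1ℚ
    ∑-stepsFrom zero    a = refl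
    ∑-stepsFrom (suc k) a = begin
      ∑ (allVecs G (suc k)) (stepsFrom G a)
        ≡⟨ ∑-allVecs-suc k (stepsFrom G a) ⟩
      ∑[ b ∈ allFin n ] ∑[ r ∈ allVecs G k ] (step G a b * stepsFrom G b r)
        ≡⟨ ∑-cong (allFin n) (λ b → *-distribˡ-∑ (step G a b) (allVecs G k) (stepsFrom G b)) ⟩
      ∑[ b ∈ allFin n ] (step G a b * ∑ (allVecs G k) (stepsFrom G b))
        ≡⟨ ∑-cong (allFin n) (λ b → trans (cong (step G a b *_) (∑-stepsFrom k b)) (ℚ.*-identityʳ _)) ⟩
      ∑ (allFin n) (step G a)
        ≡⟨ step-row-sum a ⟩
      1ℚ ∎
      where open ≡-Reasoning

    Pr-true : ∀ a k → Pr G a k (λ _ → true) ≡ 1ℚ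
    Pr-true a k = trans (Pr-start a k (λ _ → true)) (∑-stepsFrom k a)

    Pr-prefix : ∀ x i k (A : Vec (Fin n) (suc i) → Bool) →
      Pr G x (i + k) (A ∘ Vec.take (suc i)) ≡ ∑ (allVecs G (suc i)) (pathProbIf A x)
    Pr-prefix x i k A = begin
      Pr G x (i + k) (A ∘ Vec.take (suc i))
        ≡⟨ Pr-cong x (i + k) (λ w → sym (∧-identityʳ (A (Vec.take (suc i) w)))) ⟩
      Pr G x (i + k) (λ w → A (Vec.take (suc i) w) ∧ true)
        ≡⟨ Pr-markov x i k A (λ _ → true) ⟩
      ∑[ p ∈ allVecs G (suc i) ] (pathProbIf A x p * Pr G (Vec.last p) k (λ _ → true))
        ≡⟨ ∑-cong (allVecs G (suc i)) (λ p →
             trans (cong (pathProbIf A x p *_) (Pr-true (Vec.last p) k)) (ℚ.*-identityʳ _)) ⟩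
      ∑ (allVecs G (suc i)) (pathProbIf A x) ∎
      where open ≡-Reasoning

    Pr-pinned : ∀ x i k (A : Vec (Fin n) (suc i) → Bool) (B : Fin n → Bool) u →
      (∀ p → A p ≡ true → Vec.last p ≡ u) →
      Pr G x (i + k) (λ w → A (Vec.take (suc i) w) ∧ B (Vec.last w))
        ≡ Pr G u k (B ∘ Vec.last) * Pr G x (i + k) (A ∘ Vec.take (suc i))
    Pr-pinned x i k A B u pinned = begin
      Pr G x (i + k) (λ w → A (Vec.take (suc i) w) ∧ B (Vec.last w))
        ≡⟨ Pr-markov x i k A B ⟩
      ∑[ p ∈ allVecs G (suc i) ] (pathProbIf A x p * Pr G (Vec.last p) k (B ∘ Vec.last))
        ≡⟨ ∑-cong (allVecs G (suc i)) at-u ⟩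
      ∑[ p ∈ allVecs G (suc i) ] (Pr[B]ᵤ * pathProbIf A x p)
        ≡⟨ *-distribˡ-∑ Pr[B]ᵤ (allVecs G (suc i)) (pathProbIf A x) ⟩
      Pr[B]ᵤ * ∑ (allVecs G (suc i)) (pathProbIf A x)
        ≡⟨ cong (Pr[B]ᵤ *_) (Pr-prefix x i k A) ⟨
      Pr[B]ᵤ * Pr G x (i + k) (A ∘ Vec.take (suc i)) ∎
      where
      open ≡-Reasoning
      Pr[B]ᵤ = Pr G u k (B ∘ Vec.last)
      at-u : ∀ p → pathProbIf A x p * Pr G (Vec.last p) k (B ∘ Vec.last) ≡ Pr[B]ᵤ * pathProbIf A x p
      at-u p with A p in Ap≡true
      ... | true  = trans (cong (λ a → pathProb G x p * Pr G a k (B ∘ Vec.last)) (pinned p Ap≡true))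
                          (ℚ.*-comm (pathProb G x p) Pr[B]ᵤ)
      ... | false = trans (ℚ.*-zeroˡ (Pr G (Vec.last p) k (B ∘ Vec.last))) (sym (ℚ.*-zeroʳ Pr[B]ᵤ))

    Pr-endpoint-∈ : ∀ x i k (A : Vec (Fin n) (suc i) → Bool) (B : Fin n → Bool) {lo hi} →
      (∀ a → Pr G a k (B ∘ Vec.last) ∈[ lo , hi ]) →
      let Pr[A] = Pr G x (i + k) (A ∘ Vec.take (suc i)) in
      Pr G x (i + k) (λ w → A (Vec.take (suc i) w) ∧ B (Vec.last w)) ∈[ lo * Pr[A] , hi * Pr[A] ]
    Pr-endpoint-∈ x i k A B {lo} {hi} endpoint∈ =
      subst₂ (λ P Q → P ∈[ lo * Q , hi * Q ]) (sym (Pr-markov x i k A B)) (sym (Pr-prefix x i k A))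
        (∑-weighted-∈ (allVecs G (suc i)) (λ p → if-nonNeg (A p) (pathProb-nonNeg x p))
                                            (λ p → endpoint∈ (Vec.last p)))

    conditioning-on-endpoint : ∀ x i k (E : Vec (Fin n) (suc i) → Bool) (u v : Fin n) {lo hi β} →
      (∀ a → μτ G k a v ∈[ lo , hi ]) → 0ℚ ≤ β → hi - lo ≤ β * lo →
      0ℚ < Pr G x (i + k) (λ w → ⌊ Vec.last w Fin.≟ v ⌋ ∧ E (Vec.take (suc i) w)) →
      ∣ CondPr G x (i + k)
          (λ w → ⌊ Vec.last (Vec.take (suc i) w) Fin.≟ u ⌋)
          (λ w → ⌊ Vec.last w Fin.≟ v ⌋ ∧ E (Vec.take (suc i) w))
        - CondPr G x (i + k)
          (λ w → ⌊ Vec.last (Vec.take (suc i) w) Fin.≟ u ⌋)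
          (λ w → E (Vec.take (suc i) w)) ∣
        ≤ β
    conditioning-on-endpoint x i k E u v μτ∈ 0≤β margin 0<P₂ =
      ratio-perturbation P₁≡ (Pr-nonNeg x (i + k) _) (Pr-∧-≤ x (i + k) _ _) 0<P₂ 0<P₄ (μτ∈ u) P₂∈ 0≤β margin
      where
      at-u : Vec (Fin n) (suc i) → Bool
      at-u p = ⌊ Vec.last p Fin.≟ u ⌋
      is-v : Fin n → Bool
      is-v b = ⌊ b Fin.≟ v ⌋
      pinned : ∀ p → at-u p ∧ E p ≡ true → Vec.last p ≡ u
      pinned p with Vec.last p Fin.≟ u
      ... | yes last≡u = λ _ → last≡u
      ... | no  _      = λ ()
      ∧-swapʳ : ∀ a b e → a ∧ (b ∧ e) ≡ (a ∧ e) ∧ b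
      ∧-swapʳ a b e = trans (cong (a ∧_) (∧-comm b e)) (sym (∧-assoc a e b))
      P₁≡ = trans
        (Pr-cong x (i + k) λ w → ∧-swapʳ (at-u (Vec.take (suc i) w)) (is-v (Vec.last w)) (E (Vec.take (suc i) w)))
        (Pr-pinned x i k (λ p → at-u p ∧ E p) is-v u pinned)
      P₂∈ = subst (λ P → P ∈[ _ , _ ])
        (Pr-cong x (i + k) λ w → ∧-comm (E (Vec.take (suc i) w)) (is-v (Vec.last w)))
        (Pr-endpoint-∈ x i k E is-v μτ∈)
      0<P₄ = ℚ.<-≤-trans 0<P₂ (Pr-∧-≤ x (i + k) _ _)

  stationary-lower-bound : ∀ {D c} → IsUniform G D c → (∀ v → 0 ℕ.< degree G v) → 1ℚ ≤ c →
    ∀ v → 1ℚ ≤ μ G v * (c * ℕtoℚ n)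
  stationary-lower-bound {D} {c} uniform deg>0 1≤c v = *-cancelʳ-≤ 0<D (begin
    1ℚ * D                 ≡⟨ ℚ.*-identityˡ D ⟩
    D                      ≤⟨ proj₁ (uniform v) ⟩
    d                      ≡⟨ /'-*-cancel d (pos⇒≢0 0<S) ⟨
    μ G v * S              ≤⟨ *-monoˡ-≤ (/'-nonNeg (ℕtoℚ-nonNeg (degree G v)) 0<S) S≤NcD ⟩
    μ G v * (N * (c * D))  ≡⟨ solve 4 (λ m N c D → m :* (N :* (c :* D)) := m :* (c :* N) :* D)
                                refl (μ G v) N c D ⟩
    μ G v * (c * N) * D    ∎)
    where
    open ℚ.≤-Reasoning
    N = ℕtoℚ n
    d = ℕtoℚ (degree G v)
    S = ℕtoℚ (sumℕ (List.map (degree G) (allFin n)))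
    S≡ : S ≡ ∑ (allFin n) (ℕtoℚ ∘ degree G)
    S≡ = ℕtoℚ-sum (allFin n) (degree G)
    0<d : 0ℚ < d
    0<d = ℕtoℚ-pos (deg>0 v)
    0<S : 0ℚ < S
    0<S = begin-strict
      0ℚ                              <⟨ 0<d ⟩
      d                               ≤⟨ ∑-≥-member (ℕtoℚ-nonNeg ∘ degree G) (∈-allFin v) ⟩
      ∑ (allFin n) (ℕtoℚ ∘ degree G)  ≡⟨ S≡ ⟨
      S                               ∎
    S≤NcD : S ≤ N * (c * D)
    S≤NcD = begin
      S                                        ≡⟨ S≡ ⟩
      ∑ (allFin n) (ℕtoℚ ∘ degree G)           ≤⟨ ∑-mono-≤ (allFin n) (proj₂ ∘ uniform) ⟩
      ∑[ _ ∈ allFin n ] (c * D)                ≡⟨ ∑-const (allFin n) (c * D) ⟩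
      ℕtoℚ (List.length (allFin n)) * (c * D)  ≡⟨ cong (λ l → ℕtoℚ l * (c * D)) (length-tabulate (id {A = Fin n})) ⟩
      N * (c * D)                              ∎
    0<D : 0ℚ < D
    0<D = ℚ.*-cancelˡ-<-nonNeg c {{ℚ.nonNegative (ℚ.≤-trans (ℚ.<⇒≤ 0<1) 1≤c)}} (begin-strict
      c * 0ℚ  ≡⟨ ℚ.*-zeroʳ c ⟩
      0ℚ      <⟨ 0<d ⟩
      d       ≤⟨ proj₂ (uniform v) ⟩
      c * D   ∎)

proposition6 : ∀ {n : ℕ} (G : Graph n) (D c : ℚ) (T : ℕ) →
    1ℚ ≤ c →
    IsUniform G D c →
    (∀ v → 0 ℕ.< degree G v) →
    IsMixingTime G ((1ℚ /' (ℕtoℚ 2 * c * ℕtoℚ n)) * (1ℚ /' (ℕtoℚ 2 * c * ℕtoℚ n))) T →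
    (x : Fin n) (i k : ℕ) → T ℕ.≤ k →
    (E : Vec (Fin n) (suc i) → Bool) →
    (u v : Fin n) →
    0ℚ < Pr G x (i + k) (λ w → ⌊ Vec.last w Fin.≟ v ⌋ ∧ E (Vec.take (suc i) w)) →
    ∣ CondPr G x (i + k)
          (λ w → ⌊ Vec.last (Vec.take (suc i) w) Fin.≟ u ⌋)
          (λ w → ⌊ Vec.last w Fin.≟ v ⌋ ∧ E (Vec.take (suc i) w))
      - CondPr G x (i + k)
          (λ w → ⌊ Vec.last (Vec.take (suc i) w) Fin.≟ u ⌋)
          (λ w → E (Vec.take (suc i) w)) ∣
      ≤ ℕtoℚ 2 /' (ℕtoℚ 3 * c * ℕtoℚ n)
proposition6 {n} G D c T 1≤c uniform deg>0 (mixed , _) x i k T≤k E u v 0<P₂ =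
  conditioning-on-endpoint G deg>0 x i k E u v μτ-close (/'-nonNeg (ℕtoℚ-nonNeg 2) (0<[1+m]cN 2)) margin 0<P₂
  where
  N = ℕtoℚ n
  h = 1ℚ /' (ℕtoℚ 2 * c * N)
  β = ℕtoℚ 2 /' (ℕtoℚ 3 * c * N)
  1≤N : 1ℚ ≤ N
  1≤N = 1≤ℕtoℚ (ℕ.>-nonZero⁻¹ n {{nonZeroIndex x}})
  0<[1+m]cN : ∀ m → 0ℚ < ℕtoℚ (suc m) * c * N
  0<[1+m]cN m = 0<p*q (0<p*q (ℕtoℚ-pos {suc m} ℕ.z<s) (ℚ.<-≤-trans 0<1 1≤c)) (ℚ.<-≤-trans 0<1 1≤N)
  μτ-close : ∀ a → μτ G k a v ∈[ μ G v - h * h , μ G v ℚ.+ h * h ]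
  μτ-close a = ∣p-q∣≤r⇒∈ (mixed k T≤k a v)
  margin : (μ G v ℚ.+ h * h) - (μ G v - h * h) ≤ β * (μ G v - h * h)
  margin = mixing-margin {μ G v} {h} {β} {c} {N} (1≤p*q 1≤c 1≤N) (stationary-lower-bound G uniform deg>0 1≤c v)
    (/'-*-cancel 1ℚ (pos⇒≢0 (0<[1+m]cN 1))) (/'-*-cancel (ℕtoℚ 2) (pos⇒≢0 (0<[1+m]cN 2)))
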